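{- Let $\mathcal{G}^{(3)}$ be any $3$-uniform hypergraph and let $P_3^{(2)}$ be the path graph on three vertices, viewed as a $2$-uniform hypergraph (vertices $a,b,c$, edges $\{a,b\},\{b,c\}$). Then $\gamma_{P_I}(\mathcal{G}^{(3)}\circ_w P_3^{(2)})=\gamma_P(\mathcal{G}^{(3)}\circ_w P_3^{(2)})=|V(\mathcal{G}^{(3)})|$.
   Context: The weak corona $\mathcal{G}^{(k)}\circ_w\mathcal{H}^{(k-1)}$ of a $k$-uniform hypergraph with a $(k-1)$-uniform hypergraph is obtained by taking, for each $v\in V(\mathcal{G}^{(k)})$, a disjoint copy $\mathcal{H}_v^{(k-1)}$ of $\mathcal{H}^{(k-1)}$; its vertex set is $V(\mathcal{G}^{(k)})\cup\bigcup_v V(\mathcal{H}_v^{(k-1)})$ and its edge set is $E(\mathcal{G}^{(k)})\cup\{e_v\cup\{v\}: v\in V(\mathcal{G}^{(k)}),\ e_v\in E(\mathcal{H}_v^{(k-1)})\}$. For a hypergraph $\mathcal{H}=(V,E)$, $N[a]=\bigcup_{a\in e\in E}e$, $N(a)=N[a]\setminus\{a\}$. Power domination: given $S_0\subseteq V$, first all vertices of $\bigcup_{v\in S_0}N[v]$ become observed; then repeatedly, if all unobserved neighbors of an observed vertex $v$ lie in one edge incident to $v$, they become observed. $\gamma_P(\mathcal{H})$ is the minimum size of an $S_0$ making all vertices observed. Infectious power domination: given $S_0$, set $S=\bigcup_{v\in S_0}N[v]$; then while some nonempty $A\subseteq S$ and edge $e$ satisfy $A\subseteq e$ and [every vertex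 $v\notin S$ such that $A\cup\{v\}$ is contained in some edge lies in $e$], add the vertices of $e$ to $S$. $\gamma_{P_I}(\mathcal{H})$ is the minimum size of an $S_0$ with $S=V$ at termination. -}

module Defs where

open import Data.Nat using (ℕ; zero; suc; _+_; _*_; _≤_)
open import Data.Fin using (Fin; zero; suc; _↑ˡ_; _↑ʳ_; combine)
open import Data.Fin.Subset
  using (Subset; _∈_; _∉_; _⊆_; _∪_; _-_; ⁅_⁆; ⋃; ∣_∣; ⊥; ⊤; Nonempty)
open import Data.Fin.Subset.Properties using (_∈?_)
open import Data.Bool using (if_then_else_)
open import Data.List using (List; []; _∷_; map; filter; concatMap; _++_)
import Data.List as L
open import Data.Vec using (zipWith; toList)
import Data.Vec as V
open import Data.List.Relation.Unary.All using (All)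
open import Data.List.Membership.Propositional using () renaming (_∈_ to _∈ₗ_)
open import Data.Product using (Σ; ∃; _×_; _,_)
open import Relation.Binary.PropositionalEquality using (_≡_)
open import Relation.Binary.Construct.Closure.ReflexiveTransitive using (Star)

record Hypergraph : Set where
  constructor hypergraph
  field
    n     : ℕ
    edges : List (Subset n)
open Hypergraph public

Uniform : ℕ → Hypergraph → Set
Uniform k H = All (λ e → ∣ e ∣ ≡ k) (edges H)

image : ∀ {m k} → (Fin m → Fin k) → Subset m → Subset k
image {m} f s = ⋃ (toList (zipWith (λ b i → if b then ⁅ f i ⁆ else ⊥) s (V.allFin m)))

edgesAt : (H : Hypergraph) → Fin (n H) → List (Subset (n H))
edgesAt H a = filter (a ∈?_) (edges H)

N[_,_] : (H : Hypergraph) → Fin (n H) → Subset (n H)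
N[ H , a ] = ⋃ (edgesAt H a)

N⟨_,_⟩ : (H : Hypergraph) → Fin (n H) → Subset (n H)
N⟨ H , a ⟩ = N[ H , a ] - a

NS[_,_] : (H : Hypergraph) → Subset (n H) → Subset (n H)
NS[ H , S0 ] = ⋃ (toList (zipWith (λ b i → if b then N[ H , i ] else ⊥) S0 (V.allFin (n H))))

PDStep : (H : Hypergraph) → Subset (n H) → Subset (n H) → Set
PDStep H S S' =
  Σ (Fin (n H)) λ v → Σ (Subset (n H)) λ e →
    v ∈ S × e ∈ₗ edges H × v ∈ e ×
    (∀ w → w ∈ N⟨ H , v ⟩ → w ∉ S → w ∈ e) ×
    S' ≡ S ∪ N⟨ H , v ⟩

PowerDominating : (H : Hypergraph) → Subset (n H) → Set
PowerDominating H S0 = Star (PDStep H) NS[ H , S0 ] ⊤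

IPDStep : (H : Hypergraph) → Subset (n H) → Subset (n H) → Set
IPDStep H S S' =
  Σ (Subset (n H)) λ A → Σ (Subset (n H)) λ e →
    Nonempty A × A ⊆ S × e ∈ₗ edges H × A ⊆ e ×
    (∀ v → v ∉ S → (Σ (Subset (n H)) λ f → f ∈ₗ edges H × A ⊆ f × v ∈ f) → v ∈ e) ×
    S' ≡ S ∪ e

InfectiousPowerDominating : (H : Hypergraph) → Subset (n H) → Set
InfectiousPowerDominating H S0 = Star (IPDStep H) NS[ H , S0 ] ⊤

IsMinimum : ∀ {m} → (Subset m → Set) → ℕ → Set
IsMinimum P k = (Σ _ λ S0 → ∣ S0 ∣ ≡ k × P S0) × (∀ S0 → P S0 → k ≤ ∣ S0 ∣)

γP≡ : Hypergraph → ℕ → Set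
γP≡ H k = IsMinimum (PowerDominating H) k

γPI≡ : Hypergraph → ℕ → Set
γPI≡ H k = IsMinimum (InfectiousPowerDominating H) k

-- weak corona G ∘_w H : vertices Fin (nG + nG * nH); vertex v of G is
-- v ↑ˡ _, vertex j of the copy H_v is nG ↑ʳ combine v j.
weakCorona : Hypergraph → Hypergraph → Hypergraph
weakCorona G H = hypergraph (nG + nG * nH) (map (image gv) (edges G) ++ copyEdges)
  where
  nG = n G
  nH = n H
  gv : Fin nG → Fin (nG + nG * nH)
  gv v = v ↑ˡ (nG * nH)
  cv : Fin nG → Fin nH → Fin (nG + nG * nH)
  cv v j = nG ↑ʳ combine v j
  copyEdges = concatMap (λ v → map (λ e → ⁅ gv v ⁆ ∪ image (cv v) e) (edges H)) (L.allFin nG)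

P3 : Hypergraph
P3 = hypergraph 3 ((⁅ zero ⁆ ∪ ⁅ suc zero ⁆) ∷ (⁅ suc zero ⁆ ∪ ⁅ suc (suc zero) ⁆) ∷ [])

module Submission where

-- Proof strategy.  Write Ĝ = G ∘_w P₃ and, for a vertex v of G, let the
-- block B_v = {v, a_v, b_v, c_v} consist of v and its copy a_v – b_v – c_v
-- of P₃.  The blocks partition V(Ĝ).
--
-- Upper bound: the middle vertices S* = {b_v} dominate outright, since
-- N[b_v] = B_v; so S* is both power dominating and infectious power
-- dominating, and |S*| = |V(G)|.
--
-- Lower bound: suppose S₀ misses some block B_v.  Then "v is the only vertex
-- of B_v that may be observed" holds initially (an edge through a copy
-- vertex stays inside its block) and is preserved by both propagation
-- rules: a copy vertex can only be observed through v, but a_v and c_v are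
-- two unobserved neighbours of v lying in no common edge.  So B_v is never
-- fully observed; hence S₀ meets every block, and disjointness of the
-- blocks gives |S₀| ≥ |V(G)|.

open import Defs

open import Data.Nat using (ℕ; suc; _+_; _*_; _≤_; z≤n; s≤s)
open import Data.Nat.Properties using (≤-trans; ≤-reflexive; ≤-antisym; +-suc; n≤1+n)
open import Data.Fin using (Fin; zero; suc; _↑ˡ_; _↑ʳ_; combine; splitAt; remQuot)
open import Data.Fin.Properties
  using (↑ˡ-injective; ↑ʳ-injective; splitAt-↑ˡ; splitAt-↑ʳ; splitAt⁻¹-↑ˡ; splitAt⁻¹-↑ʳ;
         combine-injective; combine-remQuot; suc-injective; 0≢1+n; any?)
open import Data.Fin.Subset using (Subset; _∈_; _∉_; _⊆_; _∪_; _-_; ⁅_⁆; ⋃; ∣_∣; ⊥; ⊤)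
open import Data.Fin.Subset.Properties
  using (_∈?_; x∈p∪q⁻; x∈p∪q⁺; ∉⊥; ∈⊤; ⊆⊤; ⊆-antisym; x∈⁅x⁆; x∈⁅y⁆⇒x≡y; ∣⁅x⁆∣≡1; ∣⊤∣≡n; ∣⊥∣≡0;
         ∪-identityˡ; p⊆p∪q; q⊆p∪q; p─q⊆p; x∈p∧x≢y⇒x∈p-y; x∈p⇒∣p-x∣<∣p∣)
open import Data.Bool using (true; false; if_then_else_)
open import Data.List using (List; []; _∷_; map)
import Data.List as L
open import Data.Vec using (Vec; zipWith; toList; here; there; [])
  renaming (_∷_ to _∷ᵛ_)
import Data.Vec as V
open import Data.Vec.Properties using (lookup-allFin)
import Data.List.Relation.Unary.Any as Any
open import Data.List.Membership.Propositional using (find; lose) renaming (_∈_ to _∈ₗ_)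
open import Data.List.Membership.Propositional.Properties
  using (∈-map⁺; ∈-map⁻; ∈-++⁻; ∈-++⁺ʳ; ∈-concatMap⁺; ∈-concatMap⁻; ∈-filter⁺; ∈-filter⁻; ∈-allFin)
open import Data.Product using (Σ; _×_; _,_; proj₁; proj₂)
open import Data.Sum using (_⊎_; inj₁; inj₂)
open import Data.Empty using (⊥-elim) renaming (⊥ to Empty)
open import Relation.Nullary using (¬_; yes; no)
open import Relation.Binary.PropositionalEquality using (_≡_; _≢_; refl; sym; trans; cong; subst)
open import Relation.Binary.Construct.Closure.ReflexiveTransitive using (Star; ε; _◅_)
open import Function using (_∘_)

∈⋃⁻ : ∀ {k} {y : Fin k} (ps : List (Subset k)) → y ∈ ⋃ ps →
      Σ (Subset k) λ p → p ∈ₗ ps × y ∈ p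
∈⋃⁻ [] y∈ = ⊥-elim (∉⊥ y∈)
∈⋃⁻ (p ∷ ps) y∈ with x∈p∪q⁻ p (⋃ ps) y∈
... | inj₁ y∈p = p , Any.here refl , y∈p
... | inj₂ y∈ps with ∈⋃⁻ ps y∈ps
...   | q , q∈ps , y∈q = q , Any.there q∈ps , y∈q

∈⋃⁺ : ∀ {k} {y : Fin k} {p} (ps : List (Subset k)) → p ∈ₗ ps → y ∈ p → y ∈ ⋃ ps
∈⋃⁺ (q ∷ ps) (Any.here refl) y∈p = x∈p∪q⁺ (inj₁ y∈p)
∈⋃⁺ (q ∷ ps) (Any.there p∈ps) y∈p = x∈p∪q⁺ (inj₂ (∈⋃⁺ ps p∈ps y∈p))

-- The union of g(xⱼ) over the positions j selected by s.  Both 'image' and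
-- 'NS[_,_]' of Defs are (definitionally) of this shape with xs = allFin.
⋃[_∣_∶_] : ∀ {m k M} → (Fin M → Subset k) → Subset m → Vec (Fin M) m → Subset k
⋃[ g ∣ s ∶ xs ] = ⋃ (toList (zipWith (λ b i → if b then g i else ⊥) s xs))

∈⋃[]⁻ : ∀ {m k M} (g : Fin M → Subset k) (s : Subset m) (xs : Vec (Fin M) m) {y} →
        y ∈ ⋃[ g ∣ s ∶ xs ] → Σ (Fin m) λ j → j ∈ s × y ∈ g (V.lookup xs j)
∈⋃[]⁻ g [] [] y∈ = ⊥-elim (∉⊥ y∈)
∈⋃[]⁻ g (b ∷ᵛ s) (x ∷ᵛ xs) y∈ with b | x∈p∪q⁻ (if b then g x else ⊥) ⋃[ g ∣ s ∶ xs ] y∈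
... | true  | inj₁ y∈gx = zero , here , y∈gx
... | false | inj₁ y∈⊥ = ⊥-elim (∉⊥ y∈⊥)
... | _     | inj₂ y∈rest with ∈⋃[]⁻ g s xs y∈rest
...   | j , j∈s , y∈gxⱼ = suc j , there j∈s , y∈gxⱼ

∈⋃[]⁺ : ∀ {m k M} (g : Fin M → Subset k) (s : Subset m) (xs : Vec (Fin M) m) {y} j →
        j ∈ s → y ∈ g (V.lookup xs j) → y ∈ ⋃[ g ∣ s ∶ xs ]
∈⋃[]⁺ g (b ∷ᵛ s) (x ∷ᵛ xs) zero here y∈ = x∈p∪q⁺ (inj₁ y∈)
∈⋃[]⁺ g (b ∷ᵛ s) (x ∷ᵛ xs) (suc j) (there j∈s) y∈ = x∈p∪q⁺ (inj₂ (∈⋃[]⁺ g s xs j j∈s y∈))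

∈⋃all⁻ : ∀ {m k} (g : Fin m → Subset k) (s : Subset m) {y} →
         y ∈ ⋃[ g ∣ s ∶ V.allFin m ] → Σ (Fin m) λ i → i ∈ s × y ∈ g i
∈⋃all⁻ g s y∈ with ∈⋃[]⁻ g s (V.allFin _) y∈
... | i , i∈s , y∈ = i , i∈s , subst (λ z → _ ∈ g z) (lookup-allFin i) y∈

∈⋃all⁺ : ∀ {m k} (g : Fin m → Subset k) (s : Subset m) {y} i →
         i ∈ s → y ∈ g i → y ∈ ⋃[ g ∣ s ∶ V.allFin m ]
∈⋃all⁺ g s i i∈s y∈ =
  ∈⋃[]⁺ g s (V.allFin _) i i∈s (subst (λ z → _ ∈ g z) (sym (lookup-allFin i)) y∈)

image⁻ : ∀ {m k} (f : Fin m → Fin k) (s : Subset m) {y} →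
         y ∈ image f s → Σ (Fin m) λ i → i ∈ s × y ≡ f i
image⁻ f s y∈ with ∈⋃all⁻ (⁅_⁆ ∘ f) s y∈
... | i , i∈s , y∈⁅fi⁆ = i , i∈s , x∈⁅y⁆⇒x≡y _ y∈⁅fi⁆

image⁺ : ∀ {m k} (f : Fin m → Fin k) (s : Subset m) i → i ∈ s → f i ∈ image f s
image⁺ f s i i∈s = ∈⋃all⁺ (⁅_⁆ ∘ f) s i i∈s (x∈⁅x⁆ (f i))

∣p∪q∣≤∣p∣+∣q∣ : ∀ {n} (p q : Subset n) → ∣ p ∪ q ∣ ≤ ∣ p ∣ + ∣ q ∣
∣p∪q∣≤∣p∣+∣q∣ [] [] = z≤n
∣p∪q∣≤∣p∣+∣q∣ (true ∷ᵛ p) (true ∷ᵛ q) =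
  s≤s (≤-trans (n≤1+n _) (≤-trans (s≤s (∣p∪q∣≤∣p∣+∣q∣ p q)) (≤-reflexive (sym (+-suc ∣ p ∣ ∣ q ∣)))))
∣p∪q∣≤∣p∣+∣q∣ (true ∷ᵛ p) (false ∷ᵛ q) = s≤s (∣p∪q∣≤∣p∣+∣q∣ p q)
∣p∪q∣≤∣p∣+∣q∣ (false ∷ᵛ p) (true ∷ᵛ q) =
  ≤-trans (s≤s (∣p∪q∣≤∣p∣+∣q∣ p q)) (≤-reflexive (sym (+-suc ∣ p ∣ ∣ q ∣)))
∣p∪q∣≤∣p∣+∣q∣ (false ∷ᵛ p) (false ∷ᵛ q) = ∣p∪q∣≤∣p∣+∣q∣ p q

∣⋃[⁅⁆]∣≤ : ∀ {m k M} (f : Fin M → Fin k) (s : Subset m) (xs : Vec (Fin M) m) →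
           ∣ ⋃[ ⁅_⁆ ∘ f ∣ s ∶ xs ] ∣ ≤ ∣ s ∣
∣⋃[⁅⁆]∣≤ {k = k} f [] [] = ≤-reflexive (∣⊥∣≡0 k)
∣⋃[⁅⁆]∣≤ f (true ∷ᵛ s) (x ∷ᵛ xs) =
  ≤-trans (∣p∪q∣≤∣p∣+∣q∣ ⁅ f x ⁆ _)
          (≤-trans (≤-reflexive (cong (_+ _) (∣⁅x⁆∣≡1 (f x)))) (s≤s (∣⋃[⁅⁆]∣≤ f s xs)))
∣⋃[⁅⁆]∣≤ f (false ∷ᵛ s) (x ∷ᵛ xs) =
  subst (λ p → ∣ p ∣ ≤ ∣ s ∣) (sym (∪-identityˡ ⋃[ ⁅_⁆ ∘ f ∣ s ∶ xs ])) (∣⋃[⁅⁆]∣≤ f s xs)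

injective⇒≤∣_∣ : ∀ {m k} (S : Subset k) (f : Fin m → Fin k) →
                 (∀ i j → f i ≡ f j → i ≡ j) → (∀ i → f i ∈ S) → m ≤ ∣ S ∣
injective⇒≤∣_∣ {ℕ.zero} S f f-inj f∈S = z≤n
injective⇒≤∣_∣ {suc m} S f f-inj f∈S =
  ≤-trans (s≤s (injective⇒≤∣ S - f zero ∣ (f ∘ suc) tail-inj tail∈))
          (x∈p⇒∣p-x∣<∣p∣ (f∈S zero))
  where
  tail-inj : ∀ i j → f (suc i) ≡ f (suc j) → i ≡ j
  tail-inj i j eq = suc-injective (f-inj _ _ eq)
  tail∈ : ∀ i → f (suc i) ∈ S - f zero
  tail∈ i = x∈p∧x≢y⇒x∈p-y (f∈S (suc i)) (λ eq → 0≢1+n (sym (f-inj _ _ eq)))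

∣image-⊤∣≡ : ∀ {m k} (f : Fin m → Fin k) → (∀ i j → f i ≡ f j → i ≡ j) →
             ∣ image f ⊤ ∣ ≡ m
∣image-⊤∣≡ {m} f f-inj =
  ≤-antisym (≤-trans (∣⋃[⁅⁆]∣≤ f ⊤ (V.allFin m)) (≤-reflexive (∣⊤∣≡n m)))
            (injective⇒≤∣ image f ⊤ ∣ f f-inj (λ i → image⁺ f ⊤ i ∈⊤))

Star-preserves : ∀ {k} {R : Subset k → Subset k → Set} (P : Subset k → Set) →
                 (∀ {S S'} → P S → R S S' → P S') →
                 ∀ {S S'} → Star R S S' → P S → P S'
Star-preserves P step ε p = p
Star-preserves P step (r ◅ rs) p = Star-preserves P step rs (step p r)

module _ (H : Hypergraph) where

  N⁻ : ∀ a {y} → y ∈ N[ H , a ] → Σ (Subset (n H)) λ f → f ∈ₗ edges H × a ∈ f × y ∈ f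
  N⁻ a y∈ with ∈⋃⁻ (edgesAt H a) y∈
  ... | f , f∈ , y∈f with ∈-filter⁻ (a ∈?_) {xs = edges H} f∈
  ...   | f∈H , a∈f = f , f∈H , a∈f , y∈f

  N⁺ : ∀ a {y f} → f ∈ₗ edges H → a ∈ f → y ∈ f → y ∈ N[ H , a ]
  N⁺ a f∈H a∈f y∈f = ∈⋃⁺ (edgesAt H a) (∈-filter⁺ (a ∈?_) f∈H a∈f) y∈f

  NS⁻ : ∀ S₀ {y} → y ∈ NS[ H , S₀ ] → Σ (Fin (n H)) λ i → i ∈ S₀ × y ∈ N[ H , i ]
  NS⁻ S₀ = ∈⋃all⁻ N[ H ,_] S₀

  NS⁺ : ∀ S₀ {y} i → i ∈ S₀ → y ∈ N[ H , i ] → y ∈ NS[ H , S₀ ]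
  NS⁺ S₀ = ∈⋃all⁺ N[ H ,_] S₀

  dominating⇒powerDominating : ∀ S₀ → NS[ H , S₀ ] ≡ ⊤ →
    InfectiousPowerDominating H S₀ × PowerDominating H S₀
  dominating⇒powerDominating S₀ NS≡⊤ =
    subst (Star (IPDStep H) NS[ H , S₀ ]) NS≡⊤ ε , subst (Star (PDStep H) NS[ H , S₀ ]) NS≡⊤ ε

module Corona (G K : Hypergraph) where

  Ĝ : Hypergraph
  Ĝ = weakCorona G K

  base : Fin (n G) → Fin (n Ĝ)
  base v = v ↑ˡ (n G * n K)

  copy : Fin (n G) → Fin (n K) → Fin (n Ĝ)
  copy v j = n G ↑ʳ combine v j

  base≢copy : ∀ v w j → base v ≢ copy w j
  base≢copy v w j eq
    with trans (sym (splitAt-↑ˡ (n G) v _)) (trans (cong (splitAt (n G)) eq) (splitAt-↑ʳ (n G) _ (combine w j)))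
  ... | ()

  copy-injective : ∀ {v i w j} → copy v i ≡ copy w j → v ≡ w × i ≡ j
  copy-injective eq = combine-injective _ _ _ _ (↑ʳ-injective (n G) _ _ eq)

  lift : Fin (n G) → Subset (n K) → Subset (n Ĝ)
  lift v e = ⁅ base v ⁆ ∪ image (copy v) e

  lift∈Ĝ : ∀ v {e} → e ∈ₗ edges K → lift v e ∈ₗ edges Ĝ
  lift∈Ĝ v e∈K = ∈-++⁺ʳ (map (image base) (edges G))
    (∈-concatMap⁺ (λ w → map (lift w) (edges K)) {L.allFin (n G)} (lose (∈-allFin v) (∈-map⁺ (lift v) e∈K)))

  base∈lift : ∀ v e → base v ∈ lift v e
  base∈lift v e = x∈p∪q⁺ (inj₁ (x∈⁅x⁆ (base v)))

  copy∈lift : ∀ v {e} j → j ∈ e → copy v j ∈ lift v e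
  copy∈lift v {e} j j∈e = x∈p∪q⁺ (inj₂ (image⁺ (copy v) e j j∈e))

  lift⁻ : ∀ v e {y} → y ∈ lift v e → y ≡ base v ⊎ Σ (Fin (n K)) λ i → i ∈ e × y ≡ copy v i
  lift⁻ v e y∈ with x∈p∪q⁻ ⁅ base v ⁆ (image (copy v) e) y∈
  ... | inj₁ y∈⁅v⁆ = inj₁ (x∈⁅y⁆⇒x≡y _ y∈⁅v⁆)
  ... | inj₂ y∈img = inj₂ (image⁻ (copy v) e y∈img)

  edgeThroughCopy : ∀ {e} v j → e ∈ₗ edges Ĝ → copy v j ∈ e →
    Σ (Subset (n K)) λ e' → e' ∈ₗ edges K × e ≡ lift v e'
  edgeThroughCopy v j e∈Ĝ vj∈e with ∈-++⁻ (map (image base) (edges G)) e∈Ĝ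
  ... | inj₁ e∈G with ∈-map⁻ (image base) e∈G
  ...   | e' , _ , refl with image⁻ base e' vj∈e
  ...     | i , _ , eq = ⊥-elim (base≢copy i v j (sym eq))
  edgeThroughCopy v j e∈Ĝ vj∈e | inj₂ e∈lifts
    with find (∈-concatMap⁻ (λ w → map (lift w) (edges K)) {L.allFin (n G)} e∈lifts)
  ... | w , _ , e∈lifts-w with ∈-map⁻ (lift w) e∈lifts-w
  ...   | e' , e'∈K , refl with lift⁻ w e' vj∈e
  ...     | inj₁ eq = ⊥-elim (base≢copy w v j (sym eq))
  ...     | inj₂ (i , _ , eq) with copy-injective eq
  ...       | refl , _ = e' , e'∈K , refl

  Block : Fin (n G) → Fin (n Ĝ) → Set
  Block v y = y ≡ base v ⊎ Σ (Fin (n K)) λ j → y ≡ copy v j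

  blocks-disjoint : ∀ v w y → Block v y → Block w y → v ≡ w
  blocks-disjoint v w y (inj₁ refl) (inj₁ eq) = ↑ˡ-injective _ v w eq
  blocks-disjoint v w y (inj₁ refl) (inj₂ (j , eq)) = ⊥-elim (base≢copy v w j eq)
  blocks-disjoint v w y (inj₂ (i , refl)) (inj₁ eq) = ⊥-elim (base≢copy w v i (sym eq))
  blocks-disjoint v w y (inj₂ (i , refl)) (inj₂ (j , eq)) = proj₁ (copy-injective eq)

  blockOf : ∀ x → Σ (Fin (n G)) λ v → Block v x
  blockOf x with splitAt (n G) {n G * n K} x in eq
  ... | inj₁ v = v , inj₁ (sym (splitAt⁻¹-↑ˡ eq))
  ... | inj₂ k = proj₁ (remQuot {n G} (n K) k) , inj₂ (proj₂ (remQuot {n G} (n K) k) ,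
                   sym (trans (cong (n G ↑ʳ_) (combine-remQuot {n G} (n K) k)) (splitAt⁻¹-↑ʳ eq)))

  edgeThroughCopy⊆Block : ∀ {e} v j y → e ∈ₗ edges Ĝ → copy v j ∈ e → y ∈ e → Block v y
  edgeThroughCopy⊆Block v j y e∈Ĝ vj∈e y∈e with edgeThroughCopy v j e∈Ĝ vj∈e
  ... | e' , _ , refl with lift⁻ v e' y∈e
  ...   | inj₁ eq = inj₁ eq
  ...   | inj₂ (i , _ , eq) = inj₂ (i , eq)

  Quiet : Fin (n G) → Subset (n Ĝ) → Set
  Quiet v S = ∀ y → Block v y → y ∈ S → y ≡ base v

  Avoids : Fin (n G) → Subset (n Ĝ) → Set
  Avoids v S₀ = ∀ y → Block v y → y ∉ S₀

  quiet⇒copy∉ : ∀ {v S} j → Quiet v S → copy v j ∉ S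
  quiet⇒copy∉ j quiet vj∈S = base≢copy _ _ j (sym (quiet _ (inj₂ (j , refl)) vj∈S))

  -- If S₀ avoids B_v, the initially observed set is quiet on B_v: a copy
  -- vertex in N[i] shares an edge with i, forcing i ∈ B_v.
  avoids⇒quiet : ∀ v S₀ → Avoids v S₀ → Quiet v NS[ Ĝ , S₀ ]
  avoids⇒quiet v S₀ avoids y (inj₁ eq) _ = eq
  avoids⇒quiet v S₀ avoids y (inj₂ (j , refl)) y∈ with NS⁻ Ĝ S₀ y∈
  ... | i , i∈S₀ , y∈Ni with N⁻ Ĝ i y∈Ni
  ...   | f , f∈Ĝ , i∈f , y∈f = ⊥-elim (avoids i (edgeThroughCopy⊆Block v j i f∈Ĝ y∈f i∈f) i∈S₀)

  meets-or-avoids : ∀ v S₀ → (Σ (Fin (n Ĝ)) λ y → Block v y × y ∈ S₀) ⊎ Avoids v S₀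
  meets-or-avoids v S₀ with base v ∈? S₀ | any? (λ j → copy v j ∈? S₀)
  ... | yes v∈ | _ = inj₁ (base v , inj₁ refl , v∈)
  ... | no _ | yes (j , vj∈) = inj₁ (copy v j , inj₂ (j , refl) , vj∈)
  ... | no v∉ | no copies∉ = inj₂ avoids
    where
    avoids : Avoids v S₀
    avoids y (inj₁ refl) = v∉
    avoids y (inj₂ (j , refl)) vj∈ = copies∉ (j , vj∈)

  meets-all-blocks⇒≥ : ∀ S₀ → (∀ v → ¬ Avoids v S₀) → n G ≤ ∣ S₀ ∣
  meets-all-blocks⇒≥ S₀ meets = injective⇒≤∣ S₀ ∣ rep rep-inj (λ v → proj₂ (proj₂ (hit v)))
    where
    hit : ∀ v → Σ (Fin (n Ĝ)) λ y → Block v y × y ∈ S₀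
    hit v with meets-or-avoids v S₀
    ... | inj₁ h = h
    ... | inj₂ avoids = ⊥-elim (meets v avoids)
    rep : Fin (n G) → Fin (n Ĝ)
    rep v = proj₁ (hit v)
    rep-inj : ∀ v w → rep v ≡ rep w → v ≡ w
    rep-inj v w eq =
      blocks-disjoint v w (rep w) (subst (Block v) eq (proj₁ (proj₂ (hit v)))) (proj₁ (proj₂ (hit w)))

  quiet-preserved⇒≥ : Fin (n K) → (R : Subset (n Ĝ) → Subset (n Ĝ) → Set) →
    (∀ v {S S'} → Quiet v S → R S S' → Quiet v S') →
    ∀ S₀ → Star R NS[ Ĝ , S₀ ] ⊤ → n G ≤ ∣ S₀ ∣
  quiet-preserved⇒≥ j R preserved S₀ observes-all = meets-all-blocks⇒≥ S₀ λ v avoids →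
    quiet⇒copy∉ j (Star-preserves (Quiet v) (preserved v) observes-all (avoids⇒quiet v S₀ avoids)) ∈⊤

module CoronaP3 (G : Hypergraph) where
  open Corona G P3

  a b c : Fin 3
  a = zero
  b = suc zero
  c = suc (suc zero)

  ab bc : Subset 3
  ab = ⁅ a ⁆ ∪ ⁅ b ⁆
  bc = ⁅ b ⁆ ∪ ⁅ c ⁆

  ab∈P3 : ab ∈ₗ edges P3
  ab∈P3 = Any.here refl

  bc∈P3 : bc ∈ₗ edges P3
  bc∈P3 = Any.there (Any.here refl)

  a∈ab : a ∈ ab
  a∈ab = p⊆p∪q ⁅ b ⁆ (x∈⁅x⁆ a)

  b∈ab : b ∈ ab
  b∈ab = q⊆p∪q ⁅ a ⁆ ⁅ b ⁆ (x∈⁅x⁆ b)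

  b∈bc : b ∈ bc
  b∈bc = p⊆p∪q ⁅ c ⁆ (x∈⁅x⁆ b)

  c∈bc : c ∈ bc
  c∈bc = q⊆p∪q ⁅ b ⁆ ⁅ c ⁆ (x∈⁅x⁆ c)

  ends-not-adjacent : ∀ e → e ∈ₗ edges P3 → a ∈ e → c ∈ e → Empty
  ends-not-adjacent _ (Any.here refl) _ (there (there ()))
  ends-not-adjacent _ (Any.there (Any.here refl)) () _
  ends-not-adjacent _ (Any.there (Any.there ()))

  copy∈lift⁻ : ∀ {v e} j → copy v j ∈ lift v e → j ∈ e
  copy∈lift⁻ {v} {e} j vj∈ with lift⁻ v e vj∈
  ... | inj₁ eq = ⊥-elim (base≢copy v v j (sym eq))
  ... | inj₂ (i , i∈e , eq) with copy-injective eq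
  ...   | _ , refl = i∈e

  no-edge-through-ends : ∀ {e} v → e ∈ₗ edges Ĝ → copy v a ∈ e → copy v c ∈ e → Empty
  no-edge-through-ends v e∈Ĝ va∈e vc∈e with edgeThroughCopy v a e∈Ĝ va∈e
  ... | e' , e'∈P3 , refl = ends-not-adjacent e' e'∈P3 (copy∈lift⁻ a va∈e) (copy∈lift⁻ c vc∈e)

  ∈N⟨base⟩ : ∀ v {e} j → e ∈ₗ edges P3 → j ∈ e → copy v j ∈ N⟨ Ĝ , base v ⟩
  ∈N⟨base⟩ v {e} j e∈P3 j∈e =
    x∈p∧x≢y⇒x∈p-y (N⁺ Ĝ (base v) (lift∈Ĝ v e∈P3) (base∈lift v e) (copy∈lift v j j∈e))
                  (λ eq → base≢copy v v j (sym eq))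

  -- Power domination keeps every block quiet: observing a copy vertex needs
  -- an observed neighbour in the block, i.e. v itself, whose unobserved
  -- neighbours a_v, c_v lie in no common edge.
  pdStep-quiet : ∀ v {S S'} → Quiet v S → PDStep Ĝ S S' → Quiet v S'
  pdStep-quiet v {S} quiet (u , e , u∈S , e∈Ĝ , _ , unobserved⊆e , refl) y y∈B y∈S'
    with x∈p∪q⁻ S _ y∈S'
  ... | inj₁ y∈S = quiet y y∈B y∈S
  ... | inj₂ y∈N⟨u⟩ with y∈B
  ...   | inj₁ eq = eq
  ...   | inj₂ (j , refl) with N⁻ Ĝ u (p─q⊆p _ _ y∈N⟨u⟩)
  ...     | f , f∈Ĝ , u∈f , y∈f with quiet u (edgeThroughCopy⊆Block v j u f∈Ĝ y∈f u∈f) u∈S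
  ...       | refl = ⊥-elim (no-edge-through-ends v e∈Ĝ
                       (unobserved⊆e _ (∈N⟨base⟩ v a ab∈P3 a∈ab) (quiet⇒copy∉ a quiet))
                       (unobserved⊆e _ (∈N⟨base⟩ v c bc∈P3 c∈bc) (quiet⇒copy∉ c quiet)))

  -- Infectious power domination keeps every block quiet: an edge e newly
  -- observing a copy vertex lies in B_v, so its observed part A is ⊆ {v};
  -- then both a_v and c_v would have to lie in e.
  ipdStep-quiet : ∀ v {S S'} → Quiet v S → IPDStep Ĝ S S' → Quiet v S'
  ipdStep-quiet v {S} quiet (A , e , _ , A⊆S , e∈Ĝ , A⊆e , unobserved⊆e , refl) y y∈B y∈S'
    with x∈p∪q⁻ S e y∈S'
  ... | inj₁ y∈S = quiet y y∈B y∈S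
  ... | inj₂ y∈e with y∈B
  ...   | inj₁ eq = eq
  ...   | inj₂ (j , refl) = ⊥-elim (no-edge-through-ends v e∈Ĝ
                             (unobserved⊆e _ (quiet⇒copy∉ a quiet) (lift v ab , lift∈Ĝ v ab∈P3 , A⊆lift ab , copy∈lift v a a∈ab))
                             (unobserved⊆e _ (quiet⇒copy∉ c quiet) (lift v bc , lift∈Ĝ v bc∈P3 , A⊆lift bc , copy∈lift v c c∈bc)))
    where
    A⊆lift : ∀ e' → A ⊆ lift v e'
    A⊆lift e' z∈A = subst (_∈ lift v e')
      (sym (quiet _ (edgeThroughCopy⊆Block v j _ e∈Ĝ y∈e (A⊆e z∈A)) (A⊆S z∈A))) (base∈lift v e')

  middles : Subset (n Ĝ)
  middles = image (λ v → copy v b) ⊤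

  ∣middles∣ : ∣ middles ∣ ≡ n G
  ∣middles∣ = ∣image-⊤∣≡ (λ v → copy v b) (λ v w eq → proj₁ (copy-injective eq))

  -- N[b_v] = B_v, so the middles dominate every vertex.
  middles-dominate : NS[ Ĝ , middles ] ≡ ⊤
  middles-dominate = ⊆-antisym ⊆⊤ λ {x} _ → covered x (blockOf x)
    where
    via : ∀ v {e} → e ∈ₗ edges P3 → b ∈ e → ∀ {y} → y ∈ lift v e → y ∈ NS[ Ĝ , middles ]
    via v {e} e∈P3 b∈e y∈ =
      NS⁺ Ĝ middles (copy v b) (image⁺ _ ⊤ v ∈⊤) (N⁺ Ĝ (copy v b) (lift∈Ĝ v e∈P3) (copy∈lift v b b∈e) y∈)
    covered : ∀ x → Σ (Fin (n G)) (λ v → Block v x) → x ∈ NS[ Ĝ , middles ]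
    covered x (v , inj₁ refl) = via v ab∈P3 b∈ab (base∈lift v ab)
    covered x (v , inj₂ (zero , refl)) = via v ab∈P3 b∈ab (copy∈lift v a a∈ab)
    covered x (v , inj₂ (suc zero , refl)) = via v ab∈P3 b∈ab (copy∈lift v b b∈ab)
    covered x (v , inj₂ (suc (suc zero) , refl)) = via v bc∈P3 b∈bc (copy∈lift v c c∈bc)

corollary6p9 : (G : Hypergraph) → Uniform 3 G →
    γPI≡ (weakCorona G P3) (n G) × γP≡ (weakCorona G P3) (n G)
corollary6p9 G _ =
  ((middles , ∣middles∣ , ipd-middles) , quiet-preserved⇒≥ a (IPDStep Ĝ) ipdStep-quiet) ,
  ((middles , ∣middles∣ , pd-middles)  , quiet-preserved⇒≥ a (PDStep Ĝ) pdStep-quiet)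
  where
  open Corona G P3
  open CoronaP3 G
  ipd-middles : InfectiousPowerDominating Ĝ middles
  ipd-middles = proj₁ (dominating⇒powerDominating Ĝ middles middles-dominate)
  pd-middles : PowerDominating Ĝ middles
  pd-middles = proj₂ (dominating⇒powerDominating Ĝ middles middles-dominate)
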